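{- Let $\mathcal{P}$ be a natural unit interval order on $[1,n]$ and let $T$ be a $\mathcal{P}$-tableau. Suppose that two adjacent columns of $T$, the first immediately to the left of the second, have entries $a_1,\dots,a_p$ and $b_1,\dots,b_q$ respectively, where $a_1$ (resp. $b_1$) is the top entry and the index increases going down. Then: (1) if $a_i>b_j$ then $i\ge j$; (2) if $b_j<a_i$ and $b_j\prec a_i$ then $i>j$; (3) if $i<j$ then $a_i<b_j$.
   Context: A natural unit interval order on $[1,n]$ is a partial order $\prec$ with (i) $a\prec b\Rightarrow a<b$, and (ii) if $b\prec c$ and $a$ is incomparable to both $b,c$ then $b<a<c$. A $\mathcal{P}$-tableau of shape $\lambda\vdash n$ is a filling of the Young diagram of $\lambda$ (English convention, top-justified columns) using each element of $[1,n]$ exactly once, such that for adjacent entries: if $i$ is directly above $j$ then $i\prec j$, and if $i$ is directly left of $j$ then $j\not\prec i$. -}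

module Defs where

open import Data.Nat using (ℕ; zero; suc; _<_; _≥_; _>_)
open import Data.Fin using (Fin; toℕ)
open import Data.List using (List; []; _∷_)
open import Data.Nat.ListAction using (sum)
open import Data.List.Relation.Unary.All using (All)
open import Data.Product using (_×_; Σ; ∃; _,_)
open import Relation.Nullary using (¬_)
open import Relation.Binary.PropositionalEquality using (_≡_; _≢_)

-- The elements of [1,n] are represented by Fin n (i ↦ i+1); the usual order
-- on [1,n] is the order of toℕ.
_<ᶠ_ : ∀ {n} → Fin n → Fin n → Set
a <ᶠ b = toℕ a < toℕ b

record IsStrictPartialOrder {n : ℕ} (_≺_ : Fin n → Fin n → Set) : Set where
  field
    irrefl : ∀ a → ¬ (a ≺ a)
    trans  : ∀ {a b c} → a ≺ b → b ≺ c → a ≺ c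

Incomparable : ∀ {n} → (Fin n → Fin n → Set) → Fin n → Fin n → Set
Incomparable _≺_ a b = a ≢ b × ¬ (a ≺ b) × ¬ (b ≺ a)

record IsNUIO {n : ℕ} (_≺_ : Fin n → Fin n → Set) : Set where
  field
    partialOrder : IsStrictPartialOrder _≺_
    natural      : ∀ {a b} → a ≺ b → a <ᶠ b
    unitInterval : ∀ {a b c} → b ≺ c → Incomparable _≺_ a b → Incomparable _≺_ a c
                   → (b <ᶠ a) × (a <ᶠ c)

data Decreasing : List ℕ → Set where
  []  : Decreasing []
  [_] : ∀ x → Decreasing (x ∷ [])
  _∷_ : ∀ {x y ys} → y Data.Nat.≤ x → Decreasing (y ∷ ys) → Decreasing (x ∷ y ∷ ys)

IsPartitionOf : List ℕ → ℕ → Set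
IsPartitionOf λ' n = Decreasing λ' × All (λ k → 0 < k) λ' × sum λ' ≡ n

rowLen : List ℕ → ℕ → ℕ
rowLen []       _       = 0
rowLen (x ∷ _)  zero    = x
rowLen (_ ∷ xs) (suc r) = rowLen xs r

-- cell (r , c) (row r, column c, 0-indexed, English convention) lies in λ
InShape : List ℕ → ℕ → ℕ → Set
InShape λ' r c = c < rowLen λ' r

-- A P-tableau of shape λ: a filling T (values outside the diagram are irrelevant)
-- that is a bijection from the cells of λ onto [1,n], with the column and row conditions.
record IsPTableau {n : ℕ} (_≺_ : Fin n → Fin n → Set) (λ' : List ℕ)
                  (T : ℕ → ℕ → Fin n) : Set where
  field
    injective  : ∀ {r c r' c'} → InShape λ' r c → InShape λ' r' c'
                 → T r c ≡ T r' c' → (r ≡ r') × (c ≡ c')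
    surjective : ∀ (x : Fin n) → ∃ λ r → ∃ λ c → InShape λ' r c × T r c ≡ x
    columns    : ∀ {r c} → InShape λ' r c → InShape λ' (suc r) c → T r c ≺ T (suc r) c
    rows       : ∀ {r c} → InShape λ' r c → InShape λ' r (suc c) → ¬ (T r (suc c) ≺ T r c)

-- Columns of a P-tableau are ≺-chains. For (3), let a'_j be the entry left of
-- b_j; then a_i ≺ a'_j while b_j ⊀ a'_j by the row condition. If b_j were not
-- above a_i in [1,n], it would be ≺-incomparable to both a_i and a'_j, and the
-- unit-interval axiom would give a_i < b_j after all. Part (1) is the
-- contrapositive of (3), and in (2) the case i = j is excluded by the row
-- condition.

module Submission where

open import Defs
open import Data.Nat using (ℕ; suc; zero; _<_; _≥_; _>_; _≤_; z≤n; s≤s)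
open import Data.Nat.Properties
  using (≤-trans; n≤1+n; <-asym; ≮⇒≥; m≤n⇒m<n∨m≡n; 1+n≢n; _<?_)
open import Data.Fin using (Fin; toℕ)
open import Data.List using (List)
open import Data.Product using (_×_; _,_; proj₁; proj₂)
open import Data.Sum using (inj₁; inj₂)
open import Data.Empty using (⊥-elim)
open import Relation.Nullary using (¬_)
open import Relation.Nullary.Decidable using (decidable-stable)
open import Relation.Binary.PropositionalEquality using (_≢_; refl)

module _ {n : ℕ} {_≺_ : Fin n → Fin n → Set} (N : IsNUIO _≺_) where
  open IsNUIO N
  open IsStrictPartialOrder partialOrder

  nuio-<ᶠ-of-≺-⊀ : ∀ {a b x} → a ≺ b → ¬ (x ≺ b) → x ≢ b → a <ᶠ x
  nuio-<ᶠ-of-≺-⊀ {a} {b} {x} a≺b x⊀b x≢b =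
    decidable-stable (toℕ a <? toℕ x) λ a≮x →
      a≮x (proj₁ (unitInterval a≺b (x≢a , x⊀a , a⊀x a≮x) (x≢b , x⊀b , b⊀x a≮x)))
    where
    x≢a : x ≢ a
    x≢a refl = x⊀b a≺b
    x⊀a : ¬ (x ≺ a)
    x⊀a x≺a = x⊀b (trans x≺a a≺b)
    a⊀x : ¬ (a <ᶠ x) → ¬ (a ≺ x)
    a⊀x a≮x a≺x = a≮x (natural a≺x)
    b⊀x : ¬ (a <ᶠ x) → ¬ (b ≺ x)
    b⊀x a≮x b≺x = a⊀x a≮x (trans a≺b b≺x)

rowLen-decreasing : ∀ {λ'} → Decreasing λ' → ∀ r → rowLen λ' (suc r) ≤ rowLen λ' r
rowLen-decreasing []        r       = z≤n
rowLen-decreasing [ x ]     r       = z≤n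
rowLen-decreasing (y≤x ∷ d) zero    = y≤x
rowLen-decreasing (y≤x ∷ d) (suc r) = rowLen-decreasing d r

inShape-up : ∀ {λ' r c} → Decreasing λ' → InShape λ' (suc r) c → InShape λ' r c
inShape-up {r = r} d h = ≤-trans h (rowLen-decreasing d r)

inShape-left : ∀ {λ' r c} → InShape λ' r (suc c) → InShape λ' r c
inShape-left h = ≤-trans (n≤1+n _) h

module _ {n : ℕ} {_≺_ : Fin n → Fin n → Set} {λ' : List ℕ} {T : ℕ → ℕ → Fin n}
         (Tb : IsPTableau _≺_ λ' T) where
  open IsPTableau Tb

  tableau-≢-next-column : ∀ {r c} → InShape λ' r c → InShape λ' r (suc c)
                          → T r (suc c) ≢ T r c
  tableau-≢-next-column h h′ e = 1+n≢n (proj₂ (injective h′ h e))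

  module _ (po : IsStrictPartialOrder _≺_) (d : Decreasing λ') where
    open IsStrictPartialOrder po

    tableau-column-≺ : ∀ {i j c} → i < j → InShape λ' j c → T i c ≺ T j c
    tableau-column-≺ {j = suc k} (s≤s i≤k) h with m≤n⇒m<n∨m≡n i≤k
    ... | inj₁ i<k  = trans (tableau-column-≺ i<k (inShape-up d h)) (columns (inShape-up d h) h)
    ... | inj₂ refl = columns (inShape-up d h) h

lemma3p5 : (n : ℕ) (_≺_ : Fin n → Fin n → Set) → IsNUIO _≺_
    → (λ' : List ℕ) → IsPartitionOf λ' n
    → (T : ℕ → ℕ → Fin n) → IsPTableau _≺_ λ' T
    → (c : ℕ)
    → (∀ i j → InShape λ' i c → InShape λ' j (suc c)
         → toℕ (T i c) > toℕ (T j (suc c)) → i ≥ j)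
      × (∀ i j → InShape λ' i c → InShape λ' j (suc c)
         → toℕ (T j (suc c)) < toℕ (T i c) → T j (suc c) ≺ T i c → i > j)
      × (∀ i j → InShape λ' i c → InShape λ' j (suc c)
         → i < j → toℕ (T i c) < toℕ (T j (suc c)))
lemma3p5 n _≺_ N λ' (d , _) T Tb c = part1 , part2 , part3
  where
  open IsNUIO N using (partialOrder)

  part3 : ∀ i j → InShape λ' i c → InShape λ' j (suc c)
          → i < j → toℕ (T i c) < toℕ (T j (suc c))
  part3 i j _ hj i<j =
    nuio-<ᶠ-of-≺-⊀ N (tableau-column-≺ Tb partialOrder d i<j hj′)
      (IsPTableau.rows Tb hj′ hj) (tableau-≢-next-column Tb hj′ hj)
    where
    hj′ : InShape λ' j c
    hj′ = inShape-left {λ'} hj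

  part1 : ∀ i j → InShape λ' i c → InShape λ' j (suc c)
          → toℕ (T i c) > toℕ (T j (suc c)) → i ≥ j
  part1 i j hi hj gt = ≮⇒≥ λ i<j → <-asym gt (part3 i j hi hj i<j)

  part2 : ∀ i j → InShape λ' i c → InShape λ' j (suc c)
          → toℕ (T j (suc c)) < toℕ (T i c) → T j (suc c) ≺ T i c → i > j
  part2 i j hi hj lt b≺a with m≤n⇒m<n∨m≡n (part1 i j hi hj lt)
  ... | inj₁ j<i  = j<i
  ... | inj₂ refl = ⊥-elim (IsPTableau.rows Tb hi hj b≺a)
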